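{- Let $G$ be a chordal graph, let $v$ be a simplicial vertex of $G$, let $G'=G-v$, and let $W$ be the set of vertices of $G'$ that are mandatory in $G'$ but not mandatory in $G$. Then $W\subseteq N(v)$.
   Context: A vertex is simplicial if its neighbourhood is a clique; $N(v)$ denotes the neighbourhood of $v$. For a graph $H$, a pair $\{a,b\}$ of vertices monitors an edge $e$ if $e$ lies on every shortest path between $a$ and $b$ in $H$; a set $M\subseteq V(H)$ is a monitoring edge-geodetic set (meg-set) if every edge of $H$ is monitored by some pair of vertices of $M$. A vertex is mandatory in $H$ if it belongs to every meg-set of $H$. A graph is chordal if it has no induced cycle of length at least $4$. -}

module Defs where

open import Data.Nat using (ℕ; zero; suc; _≤_)
open import Data.Fin using (Fin; toℕ; punchIn)
open import Data.Fin.Subset using (Subset; _∈_)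
open import Data.Bool using (Bool; true; false)
open import Data.Product using (_×_; Σ; ∃; ∃-syntax; _,_)
open import Data.Sum using (_⊎_)
open import Data.Empty using (⊥)
open import Relation.Binary.PropositionalEquality using (_≡_; _≢_)
open import Relation.Nullary using (¬_)
open import Function.Bundles using (_⇔_)
open import Function.Definitions using (Injective)

record Graph (n : ℕ) : Set where
  field
    adj    : Fin n → Fin n → Bool
    sym    : ∀ x y → adj x y ≡ adj y x
    irrefl : ∀ x → adj x x ≡ false

open Graph public

Adj : ∀ {n} → Graph n → Fin n → Fin n → Set
Adj G x y = adj G x y ≡ true

-- G - v : delete vertex v; vertex w of G - v is vertex (punchIn v w) of G.
delete : ∀ {n} → Graph (suc n) → Fin (suc n) → Graph n
delete G v = record
  { adj    = λ x y → adj G (punchIn v x) (punchIn v y)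
  ; sym    = λ x y → sym G (punchIn v x) (punchIn v y)
  ; irrefl = λ x → irrefl G (punchIn v x)
  }

Simplicial : ∀ {n} → Graph n → Fin n → Set
Simplicial G v = ∀ x y → Adj G v x → Adj G v y → x ≢ y → Adj G x y

CycNext : (k : ℕ) → Fin k → Fin k → Set
CycNext k i j = (suc (toℕ i) ≡ toℕ j) ⊎ ((suc (toℕ i) ≡ k) × (toℕ j ≡ 0))

InducedCycle : ∀ {n} → Graph n → (k : ℕ) → (Fin k → Fin n) → Set
InducedCycle G k c =
  Injective _≡_ _≡_ c ×
  (∀ i j → Adj G (c i) (c j) ⇔ (CycNext k i j ⊎ CycNext k j i))

Chordal : ∀ {n} → Graph n → Set
Chordal {n} G = ∀ k → 4 ≤ k → (c : Fin k → Fin n) → ¬ InducedCycle G k c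

data Walk {n} (G : Graph n) : Fin n → Fin n → Set where
  nil  : ∀ {a} → Walk G a a
  step : ∀ {a b c} → Adj G a b → Walk G b c → Walk G a c

len : ∀ {n} {G : Graph n} {a b} → Walk G a b → ℕ
len nil        = zero
len (step _ p) = suc (len p)

EdgeOn : ∀ {n} {G : Graph n} → Fin n → Fin n → ∀ {a b} → Walk G a b → Set
EdgeOn x y nil = ⊥
EdgeOn x y (step {a} {b} _ p) = ((a ≡ x) × (b ≡ y)) ⊎ ((a ≡ y) × (b ≡ x)) ⊎ EdgeOn x y p

ShortestPath : ∀ {n} {G : Graph n} {a b} → Walk G a b → Set
ShortestPath {G = G} {a} {b} p = ∀ (q : Walk G a b) → len p ≤ len q

Monitors : ∀ {n} → Graph n → Fin n → Fin n → Fin n → Fin n → Set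
Monitors G a b x y =
  Walk G a b × (∀ (p : Walk G a b) → ShortestPath p → EdgeOn x y p)

IsMEG : ∀ {n} → Graph n → Subset n → Set
IsMEG G M = ∀ x y → Adj G x y →
  ∃[ a ] ∃[ b ] (a ∈ M × b ∈ M × Monitors G a b x y)

Mandatory : ∀ {n} → Graph n → Fin n → Set
Mandatory {n} G w = ∀ (M : Subset n) → IsMEG G M → w ∈ M

{-# OPTIONS --safe #-}
-- If M is an meg-set of G, then (M - v) ∪ N(v) is an meg-set of G - v: a
-- shortest path of G between two vertices other than v can be shortcut
-- around v, because N(v) is a clique, so G and G - v have the same shortest
-- paths between such vertices; and a pair {v, b} monitoring an edge of G - v
-- can be replaced by {u, b}, where u is the successor of v on a shortest
-- v-b path. Hence a vertex of G - v lying in every meg-set of G - v but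
-- outside N(v) lies in every meg-set of G.
module Submission where

open import Defs
open import Data.Nat using (ℕ; suc; zero; _≤_; _<_; z≤n; s≤s; _+_)
open import Data.Nat.Properties
  using (≤-trans; m≤n⇒m≤1+n; ≮⇒≥; +-comm; anyUpTo?; module ≤-Reasoning)
open import Data.Nat.Induction using (<-wellFounded)
open import Data.Fin using (Fin; punchIn; punchOut; _≟_)
open import Data.Fin.Properties
  using (any?; punchInᵢ≢i; punchIn-injective; punchIn-punchOut)
open import Data.Fin.Subset using (Subset; _∈_; _∪_)
open import Data.Fin.Subset.Properties using (x∈p∪q⁺; x∈p∪q⁻)
open import Data.Bool using (Bool; true)
import Data.Bool.Properties as Bool
open import Data.Vec using (tabulate; lookup)
open import Data.Vec.Properties using ([]=⇒lookup; lookup⇒[]=; lookup∘tabulate)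
open import Data.Product using (Σ; ∃-syntax; _×_; _,_; proj₁; proj₂)
import Data.Product as Product
open import Data.Sum using (_⊎_; inj₁; inj₂; [_,_])
import Data.Sum as Sum
open import Data.Empty using (⊥-elim)
open import Function using (id; _∘_; case_of_)
open import Induction.WellFounded using (Acc; acc)
open import Relation.Binary.Definitions using (Decidable)
open import Relation.Binary.PropositionalEquality as ≡ using (_≡_; refl; cong)
open import Relation.Nullary using (¬_; Dec; yes; no; map′)
open import Relation.Nullary.Decidable using (_×-dec_)

∈-tabulate⁺ : ∀ {n} (f : Fin n → Bool) {x} → f x ≡ true → x ∈ tabulate f
∈-tabulate⁺ f {x} fx = lookup⇒[]= x _ (≡.trans (lookup∘tabulate f x) fx)

∈-tabulate⁻ : ∀ {n} (f : Fin n → Bool) {x} → x ∈ tabulate f → f x ≡ true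
∈-tabulate⁻ f {x} x∈ = ≡.trans (≡.sym (lookup∘tabulate f x)) ([]=⇒lookup x∈)

module Walks {n} (H : Graph n) where

  Adj-sym : ∀ {a b} → Adj H a b → Adj H b a
  Adj-sym {a} {b} e = ≡.trans (sym H b a) e

  Adj-irrefl : ∀ {a} → ¬ Adj H a a
  Adj-irrefl {a} e = case ≡.trans (≡.sym e) (irrefl H a) of λ ()

  adj? : Decidable (Adj H)
  adj? a b = adj H a b Bool.≟ true

  _++_ : ∀ {a b c} → Walk H a b → Walk H b c → Walk H a c
  nil      ++ q = q
  step e p ++ q = step e (p ++ q)

  len-++ : ∀ {a b c} (p : Walk H a b) (q : Walk H b c) →
           len (p ++ q) ≡ len p + len q
  len-++ nil        q = refl
  len-++ (step e p) q = cong suc (len-++ p q)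

  EdgeOn-++⁻ : ∀ {x y a b c} (p : Walk H a b) (q : Walk H b c) →
               EdgeOn x y (p ++ q) → EdgeOn x y p ⊎ EdgeOn x y q
  EdgeOn-++⁻ nil        q xy∈q               = inj₂ xy∈q
  EdgeOn-++⁻ (step e p) q (inj₁ xy≡e)        = inj₁ (inj₁ xy≡e)
  EdgeOn-++⁻ (step e p) q (inj₂ (inj₁ yx≡e)) = inj₁ (inj₂ (inj₁ yx≡e))
  EdgeOn-++⁻ (step e p) q (inj₂ (inj₂ xy∈))  =
    Sum.map₁ (inj₂ ∘ inj₂) (EdgeOn-++⁻ p q xy∈)

  reverse : ∀ {a b} → Walk H a b → Walk H b a
  reverse nil        = nil
  reverse (step e p) = reverse p ++ step (Adj-sym e) nil

  len-reverse : ∀ {a b} (p : Walk H a b) → len (reverse p) ≡ len p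
  len-reverse nil        = refl
  len-reverse (step e p) = begin
    len (reverse p ++ step (Adj-sym e) nil) ≡⟨ len-++ (reverse p) _ ⟩
    len (reverse p) + 1                     ≡⟨ cong (_+ 1) (len-reverse p) ⟩
    len p + 1                               ≡⟨ +-comm (len p) 1 ⟩
    suc (len p)                             ∎
    where open ≡.≡-Reasoning

  EdgeOn-reverse⁻ : ∀ {x y a b} (p : Walk H a b) → EdgeOn x y (reverse p) → EdgeOn x y p
  EdgeOn-reverse⁻ (step e p) xy∈ with EdgeOn-++⁻ (reverse p) _ xy∈
  ... | inj₁ xy∈p                      = inj₂ (inj₂ (EdgeOn-reverse⁻ p xy∈p))
  ... | inj₂ (inj₁ (b≡x , a≡y))        = inj₂ (inj₁ (a≡y , b≡x))
  ... | inj₂ (inj₂ (inj₁ (b≡y , a≡x))) = inj₁ (a≡x , b≡y)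

  reverse-shortest : ∀ {a b} (p : Walk H a b) → ShortestPath p → ShortestPath (reverse p)
  reverse-shortest p p-shortest q = begin
    len (reverse p) ≡⟨ len-reverse p ⟩
    len p           ≤⟨ p-shortest (reverse q) ⟩
    len (reverse q) ≡⟨ len-reverse q ⟩
    len q           ∎
    where open ≤-Reasoning

  Monitors-sym : ∀ {a b x y} → Monitors H a b x y → Monitors H b a x y
  Monitors-sym (w , monitored) = reverse w , λ p p-shortest →
    EdgeOn-reverse⁻ p (monitored (reverse p) (reverse-shortest p p-shortest))

  ¬Monitors-loop : ∀ {a x y} → ¬ Monitors H a a x y
  ¬Monitors-loop (_ , monitored) = monitored nil (λ _ → z≤n)

  WalkOfLength : ℕ → Fin n → Fin n → Set
  WalkOfLength k a b = Σ (Walk H a b) (λ p → len p ≡ k)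

  walkOfLength? : ∀ k a b → Dec (WalkOfLength k a b)
  walkOfLength? zero a b with a ≟ b
  ... | yes refl = yes (nil , refl)
  ... | no a≢b   = no λ { (nil , _) → a≢b refl ; (step _ _ , ()) }
  walkOfLength? (suc k) a b =
    map′ (λ { (c , e , p , refl) → step e p , refl })
         (λ { (step e p , refl) → _ , e , p , refl })
         (any? (λ c → adj? a c ×-dec walkOfLength? k c b))

  -- Finite branching makes "is there a strictly shorter walk?" decidable,
  -- so shortening terminates in a shortest path.
  shortest : ∀ {a b} → Walk H a b → Σ (Walk H a b) ShortestPath
  shortest p = shorten p (<-wellFounded (len p))
    where
    shorten : ∀ {a b} (p : Walk H a b) → Acc _<_ (len p) → Σ (Walk H a b) ShortestPath
    shorten p (acc shorter) with anyUpTo? (λ k → walkOfLength? k _ _) (len p)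
    ... | yes (_ , k<p , q , q≡k) = shorten q (shorter (≡.subst (_< len p) (≡.sym q≡k) k<p))
    ... | no ∄shorter = p , λ q → ≮⇒≥ λ q<p → ∄shorter (len q , q<p , q , refl)

module VertexDeletion {n} (G : Graph (suc n)) (v : Fin (suc n)) where

  open Walks

  G′ : Graph n
  G′ = delete G v

  data VertexView : Fin (suc n) → Set where
    deleted : VertexView v
    kept    : ∀ x → VertexView (punchIn v x)

  vertexView : ∀ x → VertexView x
  vertexView x with v ≟ x
  ... | yes refl = deleted
  ... | no v≢x   = ≡.subst VertexView (punchIn-punchOut v≢x) (kept (punchOut v≢x))

  lift : ∀ {a b} → Walk G′ a b → Walk G (punchIn v a) (punchIn v b)
  lift nil        = nil
  lift (step e p) = step e (lift p)

  len-lift : ∀ {a b} (p : Walk G′ a b) → len (lift p) ≡ len p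
  len-lift nil        = refl
  len-lift (step e p) = cong suc (len-lift p)

  EdgeOn-lift⁻ : ∀ {x y a b} (p : Walk G′ a b) →
                 EdgeOn (punchIn v x) (punchIn v y) (lift p) → EdgeOn x y p
  EdgeOn-lift⁻ (step e p) (inj₁ (a≡x , b≡y)) =
    inj₁ (punchIn-injective v _ _ a≡x , punchIn-injective v _ _ b≡y)
  EdgeOn-lift⁻ (step e p) (inj₂ (inj₁ (a≡y , b≡x))) =
    inj₂ (inj₁ (punchIn-injective v _ _ a≡y , punchIn-injective v _ _ b≡x))
  EdgeOn-lift⁻ (step e p) (inj₂ (inj₂ xy∈p)) = inj₂ (inj₂ (EdgeOn-lift⁻ p xy∈p))

  EdgeOn-step-lift⁻ : ∀ {x y u b} (e : Adj G v (punchIn v u)) (p : Walk G′ u b) →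
                      EdgeOn (punchIn v x) (punchIn v y) (step e (lift p)) → EdgeOn x y p
  EdgeOn-step-lift⁻ {x}     e p (inj₁ (v≡x , _))       = ⊥-elim (punchInᵢ≢i v x (≡.sym v≡x))
  EdgeOn-step-lift⁻ {y = y} e p (inj₂ (inj₁ (v≡y , _))) = ⊥-elim (punchInᵢ≢i v y (≡.sym v≡y))
  EdgeOn-step-lift⁻         e p (inj₂ (inj₂ xy∈p))      = EdgeOn-lift⁻ p xy∈p

  restrict : Subset (suc n) → Subset n
  restrict M = tabulate (lookup M ∘ punchIn v) ∪ tabulate (adj G v ∘ punchIn v)

  ∈-restrict⁺ : ∀ M {x} → punchIn v x ∈ M ⊎ Adj G v (punchIn v x) → x ∈ restrict M
  ∈-restrict⁺ M (inj₁ x∈M)  = x∈p∪q⁺ (inj₁ (∈-tabulate⁺ (lookup M ∘ punchIn v) ([]=⇒lookup x∈M)))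
  ∈-restrict⁺ M (inj₂ v~x) = x∈p∪q⁺ (inj₂ (∈-tabulate⁺ (adj G v ∘ punchIn v) v~x))

  ∈-restrict⁻ : ∀ M {x} → x ∈ restrict M → punchIn v x ∈ M ⊎ Adj G v (punchIn v x)
  ∈-restrict⁻ M {x} x∈ =
    Sum.map (lookup⇒[]= (punchIn v x) M ∘ ∈-tabulate⁻ (lookup M ∘ punchIn v))
            (∈-tabulate⁻ (adj G v ∘ punchIn v))
            (x∈p∪q⁻ _ _ x∈)

  module _ (simplicial : Simplicial G v) where

    -- A detour u - v - w through v is replaced by the edge u - w of the
    -- clique N(v), or dropped when u = w.
    lower : ∀ {a b t} (p : Walk G (punchIn v a) t) → punchIn v b ≡ t →
            Σ (Walk G′ a b) (λ q → len q ≤ len p)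
    lower {a} {b} nil a≡b with refl ← punchIn-injective v b a a≡b = nil , z≤n
    lower (step {b = c} e p) b≡t with vertexView c
    ... | kept c = Product.map (step e) s≤s (lower p b≡t)
    lower {b = b} (step e nil) b≡v | deleted = ⊥-elim (punchInᵢ≢i v b b≡v)
    lower {a} (step e (step {b = d} e′ p)) b≡t | deleted with vertexView d
    ... | deleted = ⊥-elim (Adj-irrefl G e′)
    ... | kept d with a ≟ d
    ...   | yes refl = Product.map₂ (m≤n⇒m≤1+n ∘ m≤n⇒m≤1+n) (lower p b≡t)
    ...   | no a≢d   =
      Product.map (step (simplicial _ _ (Adj-sym G e) e′ (a≢d ∘ punchIn-injective v a d)))
                  (s≤s ∘ m≤n⇒m≤1+n) (lower p b≡t)

    lift-shortest : ∀ {a b} (p : Walk G′ a b) → ShortestPath p → ShortestPath (lift p)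
    lift-shortest p p-shortest q = begin
      len (lift p) ≡⟨ len-lift p ⟩
      len p        ≤⟨ p-shortest q′ ⟩
      len q′       ≤⟨ q′≤q ⟩
      len q        ∎
      where
      open ≤-Reasoning
      q′ = proj₁ (lower q refl)
      q′≤q = proj₂ (lower q refl)

    Monitors-lower : ∀ {a b x y} →
      Monitors G (punchIn v a) (punchIn v b) (punchIn v x) (punchIn v y) → Monitors G′ a b x y
    Monitors-lower (w , monitored) = proj₁ (lower w refl) , λ p p-shortest →
      EdgeOn-lift⁻ p (monitored (lift p) (lift-shortest p p-shortest))

    Monitors-deleted : ∀ {b x y} →
      Monitors G v (punchIn v b) (punchIn v x) (punchIn v y) →
      ∃[ u ] (Adj G v (punchIn v u) × Monitors G′ u b x y)
    Monitors-deleted {b} {x} {y} (w , monitored) =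
      let q , q-shortest = shortest G w in via q refl q-shortest
      where
      via : ∀ {t} (q : Walk G v t) → punchIn v b ≡ t → ShortestPath q →
            ∃[ u ] (Adj G v (punchIn v u) × Monitors G′ u b x y)
      via nil b≡v _ = ⊥-elim (punchInᵢ≢i v b b≡v)
      via (step {b = c} e q) refl q-shortest with vertexView c
      ... | deleted = ⊥-elim (Adj-irrefl G e)
      ... | kept u  = u , e , proj₁ (lower q refl) , λ p p-shortest →
        EdgeOn-step-lift⁻ e p (monitored (step e (lift p)) λ r →
          ≤-trans (s≤s (lift-shortest p p-shortest q)) (q-shortest r))

    IsMEG-restrict : ∀ M → IsMEG G M → IsMEG G′ (restrict M)
    IsMEG-restrict M meg x y x~y =
      let a , b , a∈M , b∈M , mon = meg (punchIn v x) (punchIn v y) x~y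
      in  replace (vertexView a) (vertexView b) a∈M b∈M mon
      where
      replace : ∀ {a b} → VertexView a → VertexView b → a ∈ M → b ∈ M →
                Monitors G a b (punchIn v x) (punchIn v y) →
                ∃[ a′ ] ∃[ b′ ] (a′ ∈ restrict M × b′ ∈ restrict M × Monitors G′ a′ b′ x y)
      replace deleted  deleted  _   _   mon = ⊥-elim (¬Monitors-loop G mon)
      replace (kept a) (kept b) a∈M b∈M mon =
        a , b , ∈-restrict⁺ M (inj₁ a∈M) , ∈-restrict⁺ M (inj₁ b∈M) , Monitors-lower mon
      replace deleted  (kept b) _   b∈M mon =
        let u , v~u , mon′ = Monitors-deleted mon
        in  u , b , ∈-restrict⁺ M (inj₂ v~u) , ∈-restrict⁺ M (inj₁ b∈M) , mon′
      replace (kept a) deleted  a∈M _   mon =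
        let u , v~u , mon′ = Monitors-deleted (Monitors-sym G mon)
        in  a , u , ∈-restrict⁺ M (inj₁ a∈M) , ∈-restrict⁺ M (inj₂ v~u) , Monitors-sym G′ mon′

corollary1 : ∀ (n : ℕ) (G : Graph (suc n)) (v : Fin (suc n)) →
    Chordal G → Simplicial G v →
    ∀ (w : Fin n) → Mandatory (delete G v) w → ¬ Mandatory G (punchIn v w) →
    Adj G v (punchIn v w)
corollary1 n G v _ simplicial w mandatory′ ¬mandatory with Walks.adj? G v (punchIn v w)
... | yes v~w = v~w
... | no v≁w  = ⊥-elim (¬mandatory λ M meg →
  [ id , ⊥-elim ∘ v≁w ] (∈-restrict⁻ M (mandatory′ (restrict M) (IsMEG-restrict simplicial M meg))))
  where open VertexDeletion G v
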